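{- Let $s$, $t$ and $k$ be positive integers with $t\geq s$ and $k\geq 2$. Then \[ C_{k}(K_{s,t})=\begin{cases} 2, & \text{if } s<k;\\ 4, & \text{if } s=k;\\ t-k+3, & \text{if } k+1\leq s\leq 3k-2;\\ s+t-4k+4, & \text{if } s\geq 3k-1. \end{cases} \]
   Context: $K_{s,t}$ is the complete bipartite graph with partite sets of sizes $s$ and $t$. For a positive integer $k$, a set $S\subseteq V(G)$ is a $k$-dominating set of $G$ if every vertex $v\in V(G)\setminus S$ has at least $k$ neighbors in $S$. Two disjoint sets $A,B\subseteq V(G)$ form a $k$-coalition if neither $A$ nor $B$ is a $k$-dominating set of $G$ but $A\cup B$ is a $k$-dominating set of $G$. A $k$-coalition partition of $G$ is a partition $\Theta$ of $V(G)$ such that every set in $\Theta$ is either a $k$-dominating set of cardinality $k$ or forms a $k$-coalition with another set of $\Theta$. The $k$-coalition number $C_k(G)$ is the maximum cardinality of a $k$-coalition partition of $G$. -}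

module Defs where

open import Data.Nat using (ℕ; _≤_; _<?_)
open import Data.Bool using (Bool; true; false; _xor_)
open import Data.Fin using (Fin; toℕ; _≟_)
open import Data.Fin.Subset using (Subset; _∉_; _∩_; _∪_; ∣_∣)
open import Data.Vec using (tabulate)
open import Data.Product using (Σ; ∃; _×_)
open import Data.Sum using (_⊎_)
open import Relation.Nullary using (¬_; does)
open import Relation.Binary.PropositionalEquality using (_≡_; _≢_)

Graph : ℕ → Set
Graph n = Fin n → Subset n

inFirst : (s : ℕ) {n : ℕ} → Fin n → Bool
inFirst s v = does (toℕ v <? s)

K : (s t : ℕ) → Graph (s Data.Nat.+ t)
K s t v = tabulate (λ u → inFirst s u xor inFirst s v)

IsKDominating : {n : ℕ} → ℕ → Graph n → Subset n → Set
IsKDominating k G S = ∀ v → v ∉ S → k ≤ ∣ S ∩ G v ∣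

KCoalition : {n : ℕ} → ℕ → Graph n → Subset n → Subset n → Set
KCoalition k G A B =
  ¬ IsKDominating k G A × ¬ IsKDominating k G B × IsKDominating k G (A ∪ B)

-- A partition of Fin n into m (nonempty) classes is encoded by a surjection
-- f : Fin n → Fin m; the i-th class is f⁻¹(i).
IsPartition : {n m : ℕ} → (Fin n → Fin m) → Set
IsPartition {n} {m} f = ∀ (i : Fin m) → ∃ λ (v : Fin n) → f v ≡ i

cls : {n m : ℕ} → (Fin n → Fin m) → Fin m → Subset n
cls f i = tabulate (λ v → does (f v ≟ i))

IsKCoalitionPartition : {n m : ℕ} → ℕ → Graph n → (Fin n → Fin m) → Set
IsKCoalitionPartition {n} {m} k G f =
  IsPartition f ×
  (∀ (i : Fin m) →
     (IsKDominating k G (cls f i) × ∣ cls f i ∣ ≡ k)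
     ⊎ (∃ λ (j : Fin m) → j ≢ i × KCoalition k G (cls f i) (cls f j)))

KCoalitionNumberIs : {n : ℕ} → ℕ → Graph n → ℕ → Set
KCoalitionNumberIs {n} k G c =
  (Σ (Fin n → Fin c) λ f → IsKCoalitionPartition k G f)
  × (∀ (m : ℕ) (f : Fin n → Fin m) → IsKCoalitionPartition k G f → m ≤ c)

{-# OPTIONS --safe #-}
-- A class of a partition of K_{s,t} matters only through its profile: its numbers a and b of
-- vertices in the parts X (of size s) and Y (of size t); a set with profile (a, b) is
-- k-dominating iff (a = s or k ≤ b) and (b = t or k ≤ a). Conversely every family of profiles
-- summing to (s, t) is realised by a partition, so both bounds are statements about profiles. For the upper bound, if s < k every dominating set
-- contains Y, which leaves room for two classes only. If k ≤ s and there are m ≥ 5 classes,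
-- a coalition containing X or Y forces m ≤ 4 or m + k ≤ t + 3. Otherwise every class has a
-- partner with which it has at least k vertices on each side. Two disjoint such pairs have at
-- least 4k vertices and every other class at least one, so m + 4k ≤ s + t + 4; without them
-- the pairs form a star whose centre has fewer than k vertices on one side, so every other
-- class has a vertex on that side and m + k ≤ t + 2.
module Submission where

open import Defs
open import Data.Bool using (Bool; true; false; not; _∧_; _∨_; _xor_)
open import Data.Bool.Properties using (∧-inverseʳ; ∨-inverseʳ; ∧-zeroʳ; ∧-identityʳ; ¬-not)
  renaming (_≟_ to _≟ᵇ_)
open import Data.Empty using (⊥; ⊥-elim)
open import Data.Fin using (Fin; zero; suc; toℕ; _↑ˡ_; _↑ʳ_; _≟_)
import Data.Fin.Properties as Fin
open import Data.Fin.Subset using (Subset; ∣_∣; _∩_; _∪_)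
open import Data.List using (List; []; _∷_; length; map)
open import Data.List.Membership.Propositional using (_∈_; _∉_)
open import Data.List.Membership.Propositional.Properties using (∈-++⁺ˡ; ∈-++⁺ʳ)
open import Data.List.Properties using (map-cong-local)
open import Data.List.Relation.Unary.All as All using ([]; _∷_)
open import Data.List.Relation.Unary.All.Properties using (¬Any⇒All¬)
open import Data.List.Relation.Unary.AllPairs using ([]; _∷_)
open import Data.List.Relation.Unary.Any using (here; there; index; any?)
open import Data.List.Relation.Unary.Any.Properties using (lookup-index)
open import Data.List.Relation.Unary.Unique.Propositional using (Unique)
open import Data.Nat using (ℕ; zero; suc; _+_; _*_; _∸_; _≤_; _<_; _≤?_; _<?_; z≤n; s≤s)
  renaming (_≟_ to _≟ℕ_)
import Data.Nat.ListAction as List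
open import Data.Nat.Properties hiding (_≟_)
open import Data.Nat.Tactic.RingSolver using (solve-∀)
open import Data.Product using (Σ; ∃; _×_; _,_; proj₁; proj₂; map₂; swap)
open import Data.Sum using (_⊎_; inj₁; inj₂; [_,_]′)
open import Data.Vec using (lookup; _[_]=_)
open import Data.Vec.Functional using (updateAt; replicate; _++_)
open import Data.Vec.Functional.Properties using (updateAt-updates; updateAt-minimal; lookup-++ˡ; lookup-++ʳ)
open import Data.Vec.Properties using (lookup∘tabulate; lookup-zipWith; []=⇒lookup; lookup⇒[]=)
open import Function using (_∘_; id; const; _⇔_; mk⇔; Equivalence)
open import Relation.Binary.PropositionalEquality
open import Relation.Nullary using (¬_; yes; no; does)
open import Relation.Nullary.Decidable using (dec-true; dec-false)
open import Relation.Nullary.Negation using (contradiction)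
open import Algebra.Properties.CommutativeMonoid.Sum +-0-commutativeMonoid
  using (sum; sum-cong-≗; ∑-distrib-+; ∑-comm)
open import Algebra.Properties.CommutativeSemigroup +-commutativeSemigroup
  using (x∙yz≈y∙xz; x∙yz≈yx∙z; xy∙z≈zy∙x)

sum-const : ∀ m c → sum {m} (const c) ≡ m * c
sum-const zero    c = refl
sum-const (suc m) c = cong (c +_) (sum-const m c)

sum-mono-≤ : ∀ {m} {f g : Fin m → ℕ} → (∀ x → f x ≤ g x) → sum f ≤ sum g
sum-mono-≤ {zero}  f≤g = z≤n
sum-mono-≤ {suc m} f≤g = +-mono-≤ (f≤g zero) (sum-mono-≤ (f≤g ∘ suc))

sum-↑ : ∀ m {n} (g : Fin (m + n) → ℕ) → sum g ≡ sum (g ∘ (_↑ˡ n)) + sum (g ∘ (m ↑ʳ_))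
sum-↑ zero    g = refl
sum-↑ (suc m) g = trans (cong (g zero +_) (sum-↑ m (g ∘ suc))) (sym (+-assoc (g zero) _ _))

sum-++ : ∀ {m n} (f : Fin m → ℕ) (g : Fin n → ℕ) → sum (f ++ g) ≡ sum f + sum g
sum-++ {m} f g = trans (sum-↑ m (f ++ g)) (cong₂ _+_ (sum-cong-≗ (lookup-++ˡ f g)) (sum-cong-≗ (lookup-++ʳ f g)))

sum-updateAt : ∀ {m} (g : Fin m → ℕ) i f → sum (updateAt g i f) + g i ≡ sum g + f (g i)
sum-updateAt g zero    f = xy∙z≈zy∙x (f (g zero)) _ (g zero)
sum-updateAt g (suc i) f = begin
  g zero + sum (updateAt (g ∘ suc) i f) + g (suc i)    ≡⟨ +-assoc (g zero) _ _ ⟩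
  g zero + (sum (updateAt (g ∘ suc) i f) + g (suc i))  ≡⟨ cong (g zero +_) (sum-updateAt (g ∘ suc) i f) ⟩
  g zero + (sum (g ∘ suc) + f (g (suc i)))             ≡⟨ +-assoc (g zero) _ _ ⟨
  g zero + sum (g ∘ suc) + f (g (suc i))               ∎
  where open ≡-Reasoning

-- sum g ≥ Σ_L g + (m − |L|)·e, with the subtraction moved to the other side.
list-sum+floor≤sum : ∀ {m} e (g : Fin m → ℕ) {L} → Unique L → (∀ x → x ∉ L → e ≤ g x) →
                     m * e + List.sum (map g L) ≤ sum g + length L * e
list-sum+floor≤sum {m} e g {[]} [] e≤g = begin
  m * e + 0          ≡⟨ +-identityʳ _ ⟩
  m * e              ≡⟨ sum-const m e ⟨
  sum {m} (const e)  ≤⟨ sum-mono-≤ (λ x → e≤g x λ ()) ⟩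
  sum g              ≡⟨ +-identityʳ _ ⟨
  sum g + 0          ∎
  where open ≤-Reasoning
list-sum+floor≤sum {m} e g {i ∷ L} (i∉L ∷ unique) e≤g = begin
  m * e + (g i + List.sum (map g L))   ≡⟨ x∙yz≈y∙xz (m * e) (g i) _ ⟩
  g i + (m * e + List.sum (map g L))   ≡⟨ cong (λ xs → g i + (m * e + List.sum xs)) gₑ≡g-on-L ⟨
  g i + (m * e + List.sum (map gₑ L))  ≤⟨ +-monoʳ-≤ (g i) (list-sum+floor≤sum e gₑ unique e≤gₑ) ⟩
  g i + (sum gₑ + length L * e)        ≡⟨ x∙yz≈yx∙z (g i) (sum gₑ) _ ⟩
  sum gₑ + g i + length L * e          ≡⟨ cong (_+ length L * e) (sum-updateAt g i (const e)) ⟩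
  sum g + e + length L * e             ≡⟨ +-assoc (sum g) e _ ⟩
  sum g + (e + length L * e)           ∎
  where
  open ≤-Reasoning
  gₑ = updateAt g i (const e)
  gₑ≡g-on-L : map gₑ L ≡ map g L
  gₑ≡g-on-L = map-cong-local (All.map (λ i≢x → updateAt-minimal _ i g (i≢x ∘ sym)) i∉L)
  e≤gₑ : ∀ x → x ∉ L → e ≤ gₑ x
  e≤gₑ x x∉L with x ≟ i
  ... | yes refl = ≤-reflexive (sym (updateAt-updates i g))
  ... | no x≢i   = subst (e ≤_) (sym (updateAt-minimal x i g x≢i))
                     (e≤g x λ { (here x≡i) → x≢i x≡i ; (there x∈L) → x∉L x∈L })

sum-unique≤ : ∀ {m} (g : Fin m → ℕ) {L} → Unique L → List.sum (map g L) ≤ sum g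
sum-unique≤ {m} g {L} unique =
  subst₂ _≤_ (cong (_+ List.sum (map g L)) (*-zeroʳ m)) (trans (cong (sum g +_) (*-zeroʳ (length L))) (+-identityʳ _))
    (list-sum+floor≤sum 0 g unique λ _ _ → z≤n)

≤-sum : ∀ {m} (g : Fin m → ℕ) i → g i ≤ sum g
≤-sum g i = ≤-trans (≤-reflexive (sym (+-identityʳ (g i)))) (sum-unique≤ g {i ∷ []} ([] ∷ []))

pair≤sum : ∀ {m} (g : Fin m → ℕ) {i j} → i ≢ j → g i + g j ≤ sum g
pair≤sum g {i} {j} i≢j =
  ≤-trans (≤-reflexive (cong (g i +_) (sym (+-identityʳ (g j))))) (sum-unique≤ g ((i≢j ∷ []) ∷ [] ∷ []))

≡0-off-list : ∀ {m} (g : Fin m → ℕ) {L x} → Unique L → sum g ≤ List.sum (map g L) → x ∉ L → g x ≡ 0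
≡0-off-list g {L} unique sum≤ x∉L =
  n≤0⇒n≡0 (+-cancelʳ-≤ (List.sum (map g L)) _ 0
    (≤-trans (sum-unique≤ g (¬Any⇒All¬ L x∉L ∷ unique)) sum≤))

mass⇒bound : ∀ {m X s t k r} → m + X ≤ s + t + r → s + k ≤ X → m + k ≤ t + r
mass⇒bound {m} {X} {s} {t} {k} {r} m+X≤ s+k≤X = +-cancelˡ-≤ s _ _ (begin
  s + (m + k)  ≡⟨ x∙yz≈y∙xz s m k ⟩
  m + (s + k)  ≤⟨ +-monoʳ-≤ m s+k≤X ⟩
  m + X        ≤⟨ m+X≤ ⟩
  s + t + r    ≡⟨ +-assoc s t r ⟩
  s + (t + r)  ∎)
  where open ≤-Reasoning

∀∈⇒≤length : ∀ {m} (L : List (Fin m)) → (∀ x → x ∈ L) → m ≤ length L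
∀∈⇒≤length {m} L ∀∈ with m ≤? length L
... | yes m≤ = m≤
... | no m≰ with Fin.pigeonhole (≰⇒> m≰) (index ∘ ∀∈)
... | x , y , x<y , same-index = contradiction x≡y (Fin.<⇒≢ x<y)
  where
  x≡y : x ≡ y
  x≡y = trans (lookup-index (∀∈ x)) (trans (cong (Data.List.lookup L) same-index) (sym (lookup-index (∀∈ y))))

fresh : ∀ {m} (L : List (Fin m)) → length L < m → ∃ (_∉ L)
fresh {m} L |L|<m =
  Fin.¬∀⟶∃¬ m (_∈ L) (λ x → any? (x ≟_) L) (λ ∀∈ → <⇒≱ |L|<m (∀∈⇒≤length L ∀∈))

unique₄ : ∀ {A : Set} {i j l o : A} → i ≢ j → i ≢ l → i ≢ o → j ≢ l → j ≢ o → l ≢ o →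
          Unique (i ∷ j ∷ l ∷ o ∷ [])
unique₄ i≢j i≢l i≢o j≢l j≢o l≢o =
  (i≢j ∷ i≢l ∷ i≢o ∷ []) ∷ (j≢l ∷ j≢o ∷ []) ∷ (l≢o ∷ []) ∷ [] ∷ []

-- Every x ≠ c has g x ≥ k − g c ≥ 1; sum over c, one further class and the remaining m − 2.
star-sum-bound : ∀ {m k} (g : Fin m → ℕ) c → g c < k → (∀ x → x ≢ c → k ≤ g c + g x) → 2 ≤ m →
                 m + k ≤ sum g + 2
star-sum-bound {m} {k} g c gc<k k≤gc+g 2≤m with fresh (c ∷ []) 2≤m
... | x₀ , x₀∉[c] = begin
  m + k                                    ≤⟨ +-monoʳ-≤ m (k≤gc+g x₀ x₀≢c) ⟩
  m + (g c + g x₀)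
    ≡⟨ cong₂ _+_ (sym (*-identityʳ m)) (cong (g c +_) (sym (+-identityʳ (g x₀)))) ⟩
  m * 1 + List.sum (map g (c ∷ x₀ ∷ []))
    ≤⟨ list-sum+floor≤sum 1 g (((x₀≢c ∘ sym) ∷ []) ∷ [] ∷ []) positive ⟩
  sum g + 2                                ∎
  where
  open ≤-Reasoning
  x₀≢c : x₀ ≢ c
  x₀≢c = x₀∉[c] ∘ here
  positive : ∀ x → x ∉ c ∷ x₀ ∷ [] → 1 ≤ g x
  positive x x∉ = +-cancelˡ-≤ (g c) 1 (g x) (begin
    g c + 1    ≡⟨ +-comm (g c) 1 ⟩
    suc (g c)  ≤⟨ gc<k ⟩
    k          ≤⟨ k≤gc+g x (x∉ ∘ here) ⟩
    g c + g x  ∎)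

module _ {m} (E : Fin m → Fin m → Set) (E-sym : ∀ {x y} → E x y → E y x)
         (neighbour : ∀ x → ∃ λ y → y ≢ x × E x y)
         (no-matching : ∀ {i j l o} → Unique (i ∷ j ∷ l ∷ o ∷ []) → E i j → E l o → ⊥)
         (4≤m : 4 ≤ m) where

  private
    no-triangle : ∀ {c d l} → c ≢ d → c ≢ l → d ≢ l → E c d → E d l → E c l → ⊥
    no-triangle {c} {d} {l} c≢d c≢l d≢l Ecd Edl Ecl with fresh (c ∷ d ∷ l ∷ []) 4≤m
    ... | y , y∉ with ¬Any⇒All¬ _ y∉ | neighbour y
    ... | y≢c ∷ y≢d ∷ y≢l ∷ [] | r , r≢y , Eyr with r ≟ c | r ≟ d | r ≟ l
    ... | yes refl | _        | _        = no-matching (unique₄ y≢c y≢d y≢l c≢d c≢l d≢l) Eyr Edl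
    ... | no _     | yes refl | _        = no-matching (unique₄ y≢d y≢c y≢l (c≢d ∘ sym) d≢l c≢l) Eyr Ecl
    ... | no _     | no _     | yes refl =
      no-matching (unique₄ y≢l y≢c y≢d (c≢l ∘ sym) (d≢l ∘ sym) c≢d) Eyr Ecd
    ... | no r≢c   | no r≢d   | no _     = no-matching (unique₄ (r≢y ∘ sym) y≢c y≢d r≢c r≢d c≢d) Eyr Ecd

    two-edges⇒centre : ∀ {c d l} → c ≢ d → c ≢ l → d ≢ l → E c d → E c l → ∀ x → x ≢ c → E c x
    two-edges⇒centre {c} {d} {l} c≢d c≢l d≢l Ecd Ecl x x≢c with neighbour x
    ... | q , q≢x , Exq with q ≟ c
    ...   | yes refl = E-sym Exq
    ...   | no q≢c with x ≟ d | q ≟ d | x ≟ l | q ≟ l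
    ...     | no x≢d   | no q≢d   | _        | _        =
      ⊥-elim (no-matching (unique₄ (q≢x ∘ sym) x≢c x≢d q≢c q≢d c≢d) Exq Ecd)
    ...     | _        | _        | no x≢l   | no q≢l   =
      ⊥-elim (no-matching (unique₄ (q≢x ∘ sym) x≢c x≢l q≢c q≢l c≢l) Exq Ecl)
    ...     | yes refl | _        | yes refl | _        = ⊥-elim (d≢l refl)
    ...     | _        | yes refl | _        | yes refl = ⊥-elim (d≢l refl)
    ...     | yes refl | _        | _        | yes refl = ⊥-elim (no-triangle c≢d c≢l d≢l Ecd Exq Ecl)
    ...     | _        | yes refl | yes refl | _        = ⊥-elim (no-triangle c≢d c≢l d≢l Ecd (E-sym Exq) Ecl)

  star-centre : ∃ λ c → ∀ x → x ≢ c → E c x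
  star-centre with fresh [] (≤-trans (s≤s z≤n) 4≤m)
  ... | c , _ with neighbour c
  ... | d , d≢c , Ecd with fresh (c ∷ d ∷ []) (≤-trans (s≤s (s≤s (s≤s z≤n))) 4≤m)
  ... | l , l∉cd with ¬Any⇒All¬ _ l∉cd | neighbour l
  ... | l≢c ∷ l≢d ∷ [] | p , p≢l , Elp with p ≟ c | p ≟ d
  ...   | yes refl | _        = c , two-edges⇒centre (d≢c ∘ sym) (l≢c ∘ sym) (l≢d ∘ sym) Ecd (E-sym Elp)
  ...   | no _     | yes refl = d , two-edges⇒centre d≢c (l≢d ∘ sym) (l≢c ∘ sym) (E-sym Ecd) (E-sym Elp)
  ...   | no p≢c   | no p≢d   =
    ⊥-elim (no-matching
      (unique₄ (d≢c ∘ sym) (l≢c ∘ sym) (p≢c ∘ sym) (l≢d ∘ sym) (p≢d ∘ sym) (p≢l ∘ sym)) Ecd Elp)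

bit : Bool → ℕ
bit true  = 1
bit false = 0

count : ∀ {n} → (Fin n → Bool) → ℕ
count p = sum (bit ∘ p)

∣∣≡count : ∀ {n} (S : Subset n) → ∣ S ∣ ≡ count (lookup S)
∣∣≡count Data.Vec.[]           = refl
∣∣≡count (true  Data.Vec.∷ S) = cong suc (∣∣≡count S)
∣∣≡count (false Data.Vec.∷ S) = ∣∣≡count S

count-const : ∀ {n} (p : Fin n → Bool) b → (∀ x → p x ≡ b) → count p ≡ n * bit b
count-const {n} p b p≡b = trans (sum-cong-≗ (cong bit ∘ p≡b)) (sum-const n (bit b))

count-∨ : ∀ {n} (p q : Fin n → Bool) → (∀ x → p x ∧ q x ≡ false) →
          count (λ x → p x ∨ q x) ≡ count p + count q
count-∨ p q disjoint = trans (sum-cong-≗ bit-∨) (∑-distrib-+ (bit ∘ p) (bit ∘ q))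
  where
  bit-∨ : ∀ x → bit (p x ∨ q x) ≡ bit (p x) + bit (q x)
  bit-∨ x with p x | q x | disjoint x
  ... | true  | false | _ = refl
  ... | false | _     | _ = refl

count-complement : ∀ {n} (p : Fin n → Bool) → count p + count (not ∘ p) ≡ n
count-complement {n} p = begin
  count p + count (not ∘ p)      ≡⟨ count-∨ p (not ∘ p) (∧-inverseʳ ∘ p) ⟨
  count (λ x → p x ∨ not (p x))  ≡⟨ count-const _ true (∨-inverseʳ ∘ p) ⟩
  n * 1                          ≡⟨ *-identityʳ n ⟩
  n                              ∎
  where open ≡-Reasoning

count≡n⇒true : ∀ {n} (p : Fin n → Bool) → count p ≡ n → ∀ x → p x ≡ true
count≡n⇒true {n} p count≡n x with p x in px
... | true  = refl
... | false = contradiction (begin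
    1                ≡⟨ cong (bit ∘ not) px ⟨
    bit (not (p x))  ≤⟨ ≤-sum (bit ∘ not ∘ p) x ⟩
    count (not ∘ p)  ≡⟨ count-not≡0 ⟩
    0                ∎) λ ()
  where
  open ≤-Reasoning
  count-not≡0 : count (not ∘ p) ≡ 0
  count-not≡0 = +-cancelˡ-≡ n _ 0
    (trans (cong (_+ count (not ∘ p)) (sym count≡n)) (trans (count-complement p) (sym (+-identityʳ n))))

count≢n⇒false : ∀ {n} (p : Fin n → Bool) → count p ≢ n → ∃ λ x → p x ≡ false
count≢n⇒false {n} p count≢n = map₂ ¬-not (Fin.¬∀⟶∃¬ n (λ x → p x ≡ true) (λ x → p x ≟ᵇ true)
  λ all-true → count≢n (trans (count-const p true all-true) (*-identityʳ n)))

fibre : ∀ {n m} → (Fin n → Fin m) → Fin m → ℕ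
fibre g i = count (λ x → does (g x ≟ i))

fibre-cong : ∀ {n m} (g h : Fin n → Fin m) → g ≗ h → fibre g ≗ fibre h
fibre-cong g h g≗h i = sum-cong-≗ (λ x → cong (λ y → bit (does (y ≟ i))) (g≗h x))

fibre-++ : ∀ {n₁ n₂ m} (g : Fin n₁ → Fin m) (h : Fin n₂ → Fin m) i → fibre (g ++ h) i ≡ fibre g i + fibre h i
fibre-++ {n₁} g h i =
  trans (sum-↑ n₁ _) (cong₂ _+_ (fibre-cong _ g (lookup-++ˡ g h) i) (fibre-cong _ h (lookup-++ʳ g h) i))

fibre-const : ∀ {n m} (c i : Fin m) → fibre {n} (const c) i ≡ n * bit (does (c ≟ i))
fibre-const {n} c i = count-const {n} (λ _ → does (c ≟ i)) (does (c ≟ i)) λ _ → refl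

fibre-suc-zero : ∀ {n m} (g : Fin n → Fin m) → fibre {m = suc m} (λ x → suc (g x)) zero ≡ 0
fibre-suc-zero {n} g = trans (count-const {n} _ false λ _ → refl) (*-zeroʳ n)

1≤fibre⇒∃ : ∀ {n m} (g : Fin n → Fin m) i → 1 ≤ fibre g i → ∃ λ x → g x ≡ i
1≤fibre⇒∃ {n} g i 1≤fibre with Fin.any? (λ x → g x ≟ i)
... | yes hit = hit
... | no ¬hit = contradiction (trans (count-const _ false λ x → dec-false (g x ≟ i) (¬hit ∘ (x ,_))) (*-zeroʳ n))
                              (≢-sym (<⇒≢ 1≤fibre))

sum-indicator : ∀ {m} (c : Fin m) → sum (λ i → bit (does (c ≟ i))) ≡ 1
sum-indicator {suc m} zero    = cong suc (trans (count-const {m} _ false λ _ → refl) (*-zeroʳ m))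
sum-indicator {suc m} (suc c) = sum-indicator c

sum-fibre : ∀ {n m} (g : Fin n → Fin m) → sum (fibre g) ≡ n
sum-fibre {n} g = begin
  sum (λ i → sum (λ x → bit (does (g x ≟ i))))  ≡⟨ ∑-comm (λ i x → bit (does (g x ≟ i))) ⟩
  sum (λ x → sum (λ i → bit (does (g x ≟ i))))  ≡⟨ sum-cong-≗ (sum-indicator ∘ g) ⟩
  sum {n} (const 1)                             ≡⟨ trans (sum-const n 1) (*-identityʳ n) ⟩
  n                                             ∎
  where open ≡-Reasoning

layout : ∀ {m} (a : Fin m → ℕ) → Fin (sum a) → Fin m
layout {suc m} a = replicate (a zero) zero ++ (suc ∘ layout (a ∘ suc))

fibre-layout : ∀ {m} (a : Fin m → ℕ) i → fibre (layout a) i ≡ a i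
fibre-layout {suc m} a i = trans (fibre-++ (replicate (a zero) zero) (suc ∘ layout (a ∘ suc)) i) (blocks i)
  where
  blocks : ∀ i → fibre (replicate (a zero) zero) i + fibre (suc ∘ layout (a ∘ suc)) i ≡ a i
  blocks zero    = trans (cong₂ _+_ (trans (fibre-const {a zero} {suc m} zero zero) (*-identityʳ (a zero)))
                                   (fibre-suc-zero (layout (a ∘ suc))))
                         (+-identityʳ (a zero))
  blocks (suc i) = cong₂ _+_ (trans (fibre-const {a zero} {suc m} zero (suc i)) (*-zeroʳ (a zero)))
                             (fibre-layout (a ∘ suc) i)

-- The graph K_{s,t}

inFirst-↑ˡ : ∀ s t (x : Fin s) → inFirst s (x ↑ˡ t) ≡ true
inFirst-↑ˡ s t x = dec-true (toℕ (x ↑ˡ t) <? s) (subst (_< s) (sym (Fin.toℕ-↑ˡ x t)) (Fin.toℕ<n x))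

inFirst-↑ʳ : ∀ s t (y : Fin t) → inFirst s (s ↑ʳ y) ≡ false
inFirst-↑ʳ s t y = dec-false (toℕ (s ↑ʳ y) <? s)
  (λ lt → <⇒≱ lt (subst (s ≤_) (sym (Fin.toℕ-↑ʳ s y)) (m≤m+n s (toℕ y))))

data Side (m n : ℕ) : Fin (m + n) → Set where
  left  : (x : Fin m) → Side m n (x ↑ˡ n)
  right : (y : Fin n) → Side m n (m ↑ʳ y)

side : ∀ m n (v : Fin (m + n)) → Side m n v
side zero    n v       = right v
side (suc m) n zero    = left zero
side (suc m) n (suc v) with side m n v
... | left x  = left (suc x)
... | right y = right y

countˣ : ∀ s t → Subset (s + t) → ℕ
countˣ s t S = count (λ x → lookup S (x ↑ˡ t))

countʸ : ∀ s t → Subset (s + t) → ℕ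
countʸ s t S = count (λ y → lookup S (s ↑ʳ y))

∣∩∣≡count : ∀ {n} (S T : Subset n) → ∣ S ∩ T ∣ ≡ count (λ u → lookup S u ∧ lookup T u)
∣∩∣≡count S T = trans (∣∣≡count (S ∩ T)) (sum-cong-≗ λ u → cong bit (lookup-zipWith _∧_ u S T))

lookup-K : ∀ s t v u → lookup (K s t v) u ≡ inFirst s u xor inFirst s v
lookup-K s t v u = lookup∘tabulate (λ u → inFirst s u xor inFirst s v) u

degree-↑ˡ : ∀ s t (S : Subset (s + t)) x → ∣ S ∩ K s t (x ↑ˡ t) ∣ ≡ countʸ s t S
degree-↑ˡ s t S x = begin
  ∣ S ∩ K s t (x ↑ˡ t) ∣                                ≡⟨ ∣∩∣≡count S _ ⟩
  count (λ u → lookup S u ∧ lookup (K s t (x ↑ˡ t)) u)  ≡⟨ sum-↑ s _ ⟩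
  count (λ x′ → lookup S (x′ ↑ˡ t) ∧ lookup (K s t (x ↑ˡ t)) (x′ ↑ˡ t))
    + count (λ y → lookup S (s ↑ʳ y) ∧ lookup (K s t (x ↑ˡ t)) (s ↑ʳ y))
      ≡⟨ cong₂ _+_ (count-const _ false same-part) (sum-cong-≗ (cong bit ∘ other-part)) ⟩
  s * 0 + countʸ s t S                                  ≡⟨ cong (_+ countʸ s t S) (*-zeroʳ s) ⟩
  countʸ s t S                                          ∎
  where
  open ≡-Reasoning
  same-part : ∀ x′ → lookup S (x′ ↑ˡ t) ∧ lookup (K s t (x ↑ˡ t)) (x′ ↑ˡ t) ≡ false
  same-part x′ rewrite lookup-K s t (x ↑ˡ t) (x′ ↑ˡ t) | inFirst-↑ˡ s t x′ | inFirst-↑ˡ s t x = ∧-zeroʳ _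
  other-part : ∀ y → lookup S (s ↑ʳ y) ∧ lookup (K s t (x ↑ˡ t)) (s ↑ʳ y) ≡ lookup S (s ↑ʳ y)
  other-part y rewrite lookup-K s t (x ↑ˡ t) (s ↑ʳ y) | inFirst-↑ʳ s t y | inFirst-↑ˡ s t x = ∧-identityʳ _

degree-↑ʳ : ∀ s t (S : Subset (s + t)) y → ∣ S ∩ K s t (s ↑ʳ y) ∣ ≡ countˣ s t S
degree-↑ʳ s t S y = begin
  ∣ S ∩ K s t (s ↑ʳ y) ∣                                ≡⟨ ∣∩∣≡count S _ ⟩
  count (λ u → lookup S u ∧ lookup (K s t (s ↑ʳ y)) u)  ≡⟨ sum-↑ s _ ⟩
  count (λ x → lookup S (x ↑ˡ t) ∧ lookup (K s t (s ↑ʳ y)) (x ↑ˡ t))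
    + count (λ y′ → lookup S (s ↑ʳ y′) ∧ lookup (K s t (s ↑ʳ y)) (s ↑ʳ y′))
      ≡⟨ cong₂ _+_ (sum-cong-≗ (cong bit ∘ other-part)) (count-const _ false same-part) ⟩
  countˣ s t S + t * 0                                  ≡⟨ cong (countˣ s t S +_) (*-zeroʳ t) ⟩
  countˣ s t S + 0                                      ≡⟨ +-identityʳ _ ⟩
  countˣ s t S                                          ∎
  where
  open ≡-Reasoning
  same-part : ∀ y′ → lookup S (s ↑ʳ y′) ∧ lookup (K s t (s ↑ʳ y)) (s ↑ʳ y′) ≡ false
  same-part y′ rewrite lookup-K s t (s ↑ʳ y) (s ↑ʳ y′) | inFirst-↑ʳ s t y′ | inFirst-↑ʳ s t y = ∧-zeroʳ _
  other-part : ∀ x → lookup S (x ↑ˡ t) ∧ lookup (K s t (s ↑ʳ y)) (x ↑ˡ t) ≡ lookup S (x ↑ˡ t)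
  other-part x rewrite lookup-K s t (s ↑ʳ y) (x ↑ˡ t) | inFirst-↑ˡ s t x | inFirst-↑ʳ s t y = ∧-identityʳ _

Dominating : (s t k a b : ℕ) → Set
Dominating s t k a b = (a ≡ s ⊎ k ≤ b) × (b ≡ t ⊎ k ≤ a)

dominating⇔ : ∀ s t k (S : Subset (s + t)) {a b} → countˣ s t S ≡ a → countʸ s t S ≡ b →
              IsKDominating k (K s t) S ⇔ Dominating s t k a b
dominating⇔ s t k S refl refl = mk⇔ to from
  where
  outside : ∀ {v} → lookup S v ≡ false → ¬ S [ v ]= true
  outside v∉S v∈S = contradiction (trans (sym ([]=⇒lookup v∈S)) v∉S) λ ()
  to : IsKDominating k (K s t) S → Dominating s t k (countˣ s t S) (countʸ s t S)
  to dom = X-condition , Y-condition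
    where
    X-condition : countˣ s t S ≡ s ⊎ k ≤ countʸ s t S
    X-condition with countˣ s t S ≟ℕ s
    ... | yes full = inj₁ full
    ... | no ¬full = let x , x∉S = count≢n⇒false _ ¬full in
                     inj₂ (subst (k ≤_) (degree-↑ˡ s t S x) (dom (x ↑ˡ t) (outside x∉S)))
    Y-condition : countʸ s t S ≡ t ⊎ k ≤ countˣ s t S
    Y-condition with countʸ s t S ≟ℕ t
    ... | yes full = inj₁ full
    ... | no ¬full = let y , y∉S = count≢n⇒false _ ¬full in
                     inj₂ (subst (k ≤_) (degree-↑ʳ s t S y) (dom (s ↑ʳ y) (outside y∉S)))
  from : Dominating s t k (countˣ s t S) (countʸ s t S) → IsKDominating k (K s t) S
  from (X-condition , Y-condition) v v∉S with side s t v | X-condition | Y-condition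
  ... | left x  | inj₁ full | _         = contradiction (lookup⇒[]= _ S (count≡n⇒true _ full x)) v∉S
  ... | left x  | inj₂ k≤   | _         = subst (k ≤_) (sym (degree-↑ˡ s t S x)) k≤
  ... | right y | _         | inj₁ full = contradiction (lookup⇒[]= _ S (count≡n⇒true _ full y)) v∉S
  ... | right y | _         | inj₂ k≤   = subst (k ≤_) (sym (degree-↑ʳ s t S y)) k≤

lookup-cls : ∀ {n m} (f : Fin n → Fin m) i v → lookup (cls f i) v ≡ does (f v ≟ i)
lookup-cls f i = lookup∘tabulate (λ v → does (f v ≟ i))

count-cls : ∀ {n n′ m} (f : Fin n → Fin m) (r : Fin n′ → Fin n) i →
            count (lookup (cls f i) ∘ r) ≡ fibre (f ∘ r) i
count-cls f r i = sum-cong-≗ (cong bit ∘ lookup-cls f i ∘ r)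

count-cls-∪ : ∀ {n n′ m} (f : Fin n → Fin m) (r : Fin n′ → Fin n) {i j} → i ≢ j →
              count (lookup (cls f i ∪ cls f j) ∘ r) ≡ fibre (f ∘ r) i + fibre (f ∘ r) j
count-cls-∪ f r {i} {j} i≢j = trans (sum-cong-≗ (cong bit ∘ lookup-∪ ∘ r)) (count-∨ _ _ disjoint)
  where
  lookup-∪ : ∀ v → lookup (cls f i ∪ cls f j) v ≡ does (f v ≟ i) ∨ does (f v ≟ j)
  lookup-∪ v = trans (lookup-zipWith _∨_ v (cls f i) (cls f j)) (cong₂ _∨_ (lookup-cls f i v) (lookup-cls f j v))
  disjoint : ∀ x → does (f (r x) ≟ i) ∧ does (f (r x) ≟ j) ≡ false
  disjoint x with f (r x) ≟ i
  ... | yes refl = dec-false (i ≟ j) i≢j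
  ... | no _     = refl

-- Profiles of coalition partitions

-- Class i of a partition of K_{s,t} has a i vertices in X and b i in Y.
IsValidClass : (s t k : ℕ) {m : ℕ} (a b : Fin m → ℕ) → Fin m → Set
IsValidClass s t k a b i =
  (Dominating s t k (a i) (b i) × a i + b i ≡ k)
  ⊎ ∃ λ j → j ≢ i × ¬ Dominating s t k (a i) (b i) × ¬ Dominating s t k (a j) (b j)
                  × Dominating s t k (a i + a j) (b i + b j)

record CoalitionProfile (s t k m : ℕ) : Set where
  field
    a b      : Fin m → ℕ
    sum-a    : sum a ≡ s
    sum-b    : sum b ≡ t
    nonempty : ∀ i → 1 ≤ a i + b i
    valid    : ∀ i → IsValidClass s t k a b i

KCoalitionClass : ∀ {n m} → ℕ → Graph n → (Fin n → Fin m) → Fin m → Set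
KCoalitionClass k G f i =
  (IsKDominating k G (cls f i) × ∣ cls f i ∣ ≡ k) ⊎ (∃ λ j → j ≢ i × KCoalition k G (cls f i) (cls f j))

module _ {s t k m : ℕ} (f : Fin (s + t) → Fin m) (a b : Fin m → ℕ)
         (fibre-ˣ : ∀ i → fibre (f ∘ (_↑ˡ t)) i ≡ a i)
         (fibre-ʸ : ∀ i → fibre (f ∘ (s ↑ʳ_)) i ≡ b i) where

  size-cls : ∀ i → ∣ cls f i ∣ ≡ a i + b i
  size-cls i = trans (∣∣≡count (cls f i)) (trans (sum-↑ s _)
    (cong₂ _+_ (trans (count-cls f (_↑ˡ t) i) (fibre-ˣ i)) (trans (count-cls f (s ↑ʳ_) i) (fibre-ʸ i))))

  cls-dominating⇔ : ∀ i → IsKDominating k (K s t) (cls f i) ⇔ Dominating s t k (a i) (b i)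
  cls-dominating⇔ i = dominating⇔ s t k (cls f i)
    (trans (count-cls f (_↑ˡ t) i) (fibre-ˣ i)) (trans (count-cls f (s ↑ʳ_) i) (fibre-ʸ i))

  cls-∪-dominating⇔ : ∀ {i j} → i ≢ j →
    IsKDominating k (K s t) (cls f i ∪ cls f j) ⇔ Dominating s t k (a i + a j) (b i + b j)
  cls-∪-dominating⇔ {i} {j} i≢j = dominating⇔ s t k (cls f i ∪ cls f j)
    (trans (count-cls-∪ f (_↑ˡ t) i≢j) (cong₂ _+_ (fibre-ˣ i) (fibre-ˣ j)))
    (trans (count-cls-∪ f (s ↑ʳ_) i≢j) (cong₂ _+_ (fibre-ʸ i) (fibre-ʸ j)))

  kCoalitionClass⇔valid : ∀ i → KCoalitionClass k (K s t) f i ⇔ IsValidClass s t k a b i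
  kCoalitionClass⇔valid i = mk⇔ forward backward
    where
    open Equivalence
    forward : KCoalitionClass k (K s t) f i → IsValidClass s t k a b i
    forward (inj₁ (dom , size)) = inj₁ (cls-dominating⇔ i .to dom , trans (sym (size-cls i)) size)
    forward (inj₂ (j , j≢i , ¬domᵢ , ¬domⱼ , dom)) =
      inj₂ (j , j≢i , ¬domᵢ ∘ cls-dominating⇔ i .from , ¬domⱼ ∘ cls-dominating⇔ j .from ,
            cls-∪-dominating⇔ (j≢i ∘ sym) .to dom)
    backward : IsValidClass s t k a b i → KCoalitionClass k (K s t) f i
    backward (inj₁ (dom , size)) = inj₁ (cls-dominating⇔ i .from dom , trans (size-cls i) size)
    backward (inj₂ (j , j≢i , ¬domᵢ , ¬domⱼ , dom)) =
      inj₂ (j , j≢i , ¬domᵢ ∘ cls-dominating⇔ i .to , ¬domⱼ ∘ cls-dominating⇔ j .to ,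
            cls-∪-dominating⇔ (j≢i ∘ sym) .from dom)

partition⇒profile : ∀ {s t k m} (f : Fin (s + t) → Fin m) → IsKCoalitionPartition k (K s t) f →
                    CoalitionProfile s t k m
partition⇒profile {s} {t} f (surjective , classes) = record
  { a        = a
  ; b        = b
  ; sum-a    = sum-fibre (f ∘ (_↑ˡ t))
  ; sum-b    = sum-fibre (f ∘ (s ↑ʳ_))
  ; nonempty = λ i → let v , fv≡i = surjective i in
      subst (1 ≤_) (sum-↑ s _) (≤-trans (≤-reflexive (cong bit (sym (dec-true (f v ≟ i) fv≡i))))
                                        (≤-sum (λ v → bit (does (f v ≟ i))) v))
  ; valid    = λ i → Equivalence.to (kCoalitionClass⇔valid f a b (λ _ → refl) (λ _ → refl) i) (classes i)
  }
  where
  a = fibre (f ∘ (_↑ˡ t))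
  b = fibre (f ∘ (s ↑ʳ_))

profile⇒partition : ∀ {s t k m} → CoalitionProfile s t k m →
                    Σ (Fin (s + t) → Fin m) (IsKCoalitionPartition k (K s t))
profile⇒partition record { a = a ; b = b ; sum-a = refl ; sum-b = refl ; nonempty = nonempty ; valid = valid } =
  f , surjective , λ i → Equivalence.from (kCoalitionClass⇔valid f a b fibre-ˣ fibre-ʸ i) (valid i)
  where
  f = layout a ++ layout b
  fibre-ˣ : ∀ i → fibre (f ∘ (_↑ˡ sum b)) i ≡ a i
  fibre-ˣ i = trans (fibre-cong _ _ (lookup-++ˡ (layout a) (layout b)) i) (fibre-layout a i)
  fibre-ʸ : ∀ i → fibre (f ∘ (sum a ↑ʳ_)) i ≡ b i
  fibre-ʸ i = trans (fibre-cong _ _ (lookup-++ʳ (layout a) (layout b)) i) (fibre-layout b i)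
  surjective : IsPartition f
  surjective i = 1≤fibre⇒∃ f i (subst (1 ≤_) (sym (trans (fibre-++ (layout a) (layout b) i)
                                                         (cong₂ _+_ (fibre-layout a i) (fibre-layout b i))))
                                           (nonempty i))

swap-parts : ∀ {s t k m} → CoalitionProfile s t k m → CoalitionProfile t s k m
swap-parts {s} {t} {k} P = record
  { a = b ; b = a ; sum-a = sum-b ; sum-b = sum-a
  ; nonempty = λ i → subst (1 ≤_) (+-comm (a i) (b i)) (nonempty i)
  ; valid = swap-valid ∘ valid
  }
  where
  open CoalitionProfile P
  swap-valid : ∀ {i} → IsValidClass s t k a b i → IsValidClass t s k b a i
  swap-valid {i} (inj₁ (dom , size)) = inj₁ (swap dom , trans (+-comm (b i) (a i)) size)
  swap-valid (inj₂ (j , j≢i , ¬domᵢ , ¬domⱼ , dom)) =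
    inj₂ (j , j≢i , ¬domᵢ ∘ swap , ¬domⱼ ∘ swap , swap dom)

-- Upper bounds

dominating-interior : ∀ {s t k A B} → Dominating s t k A B → A ≢ s → B ≢ t → k ≤ A × k ≤ B
dominating-interior (inj₁ A≡s , _)        A≢s _   = contradiction A≡s A≢s
dominating-interior (_ , inj₁ B≡t)        _   B≢t = contradiction B≡t B≢t
dominating-interior (inj₂ k≤B , inj₂ k≤A) _   _   = k≤A , k≤B

non-dominating⇒small : ∀ {s t k A B} → ¬ Dominating s t k A B → A < k ⊎ B < k
non-dominating⇒small {k = k} {A} {B} ¬dom with k ≤? A | k ≤? B
... | yes k≤A | yes k≤B = contradiction (inj₂ k≤B , inj₂ k≤A) ¬dom
... | no k≰A  | _       = inj₁ (≰⇒> k≰A)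
... | yes _   | no k≰B  = inj₂ (≰⇒> k≰B)

dominating⇒whole-Y : ∀ {s t k A B} → s < k → A ≤ s → Dominating s t k A B → B ≡ t
dominating⇒whole-Y s<k A≤s (_ , inj₁ B≡t) = B≡t
dominating⇒whole-Y s<k A≤s (_ , inj₂ k≤A) = contradiction (≤-trans k≤A A≤s) (<⇒≱ s<k)

module Bounds {s t k m} (P : CoalitionProfile s t k m) where
  open CoalitionProfile P

  Dom : Fin m → Set
  Dom i = Dominating s t k (a i) (b i)

  h : Fin m → ℕ
  h i = a i + b i

  mass-bound : ∀ {L} → Unique L → m + List.sum (map h L) ≤ s + t + length L
  mass-bound {L} unique = begin
    m + List.sum (map h L)      ≡⟨ cong (_+ List.sum (map h L)) (*-identityʳ m) ⟨
    m * 1 + List.sum (map h L)  ≤⟨ list-sum+floor≤sum 1 h unique (λ x _ → nonempty x) ⟩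
    sum h + length L * 1
      ≡⟨ cong₂ _+_ (trans (∑-distrib-+ a b) (cong₂ _+_ sum-a sum-b)) (*-identityʳ (length L)) ⟩
    s + t + length L            ∎
    where open ≤-Reasoning

  covered⇒m≤ : ∀ L → (∀ {x} → x ∉ L → a x ≡ 0) → (∀ {x} → x ∉ L → b x ≡ 0) → m ≤ length L
  covered⇒m≤ L a≡0 b≡0 = ∀∈⇒≤length L member
    where
    member : ∀ x → x ∈ L
    member x with any? (x ≟_) L
    ... | yes x∈L = x∈L
    ... | no x∉L  = contradiction (subst (1 ≤_) (cong₂ _+_ (a≡0 x∉L) (b≡0 x∉L)) (nonempty x)) λ ()

  single-sum : ∀ (g : Fin m → ℕ) {i n} → g i ≡ n → n ≤ List.sum (map g (i ∷ []))
  single-sum g {i} gi≡n = ≤-reflexive (trans (sym gi≡n) (sym (+-identityʳ (g i))))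

  pair-sum : ∀ (g : Fin m → ℕ) {i j n} → g i + g j ≡ n → n ≤ List.sum (map g (i ∷ j ∷ []))
  pair-sum g {i} {j} gi+gj≡n = ≤-reflexive (trans (sym gi+gj≡n) (cong (g i +_) (sym (+-identityʳ (g j)))))

  a≡0-off-single : ∀ {i x} → a i ≡ s → x ∉ i ∷ [] → a x ≡ 0
  a≡0-off-single ai≡s = ≡0-off-list a ([] ∷ []) (subst (_≤ _) (sym sum-a) (single-sum a ai≡s))

  a≡0-off-pair : ∀ {i j x} → i ≢ j → a i + a j ≡ s → x ∉ i ∷ j ∷ [] → a x ≡ 0
  a≡0-off-pair i≢j cover = ≡0-off-list a ((i≢j ∷ []) ∷ [] ∷ []) (subst (_≤ _) (sym sum-a) (pair-sum a cover))

  b≡0-off-single : ∀ {i x} → b i ≡ t → x ∉ i ∷ [] → b x ≡ 0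
  b≡0-off-single bi≡t = ≡0-off-list b ([] ∷ []) (subst (_≤ _) (sym sum-b) (single-sum b bi≡t))

  b≡0-off-pair : ∀ {i j x} → i ≢ j → b i + b j ≡ t → x ∉ i ∷ j ∷ [] → b x ≡ 0
  b≡0-off-pair i≢j cover = ≡0-off-list b ((i≢j ∷ []) ∷ [] ∷ []) (subst (_≤ _) (sym sum-b) (pair-sum b cover))

  a≤s : ∀ i → a i ≤ s
  a≤s i = subst (a i ≤_) sum-a (≤-sum a i)

  a-pair≤s : ∀ {i j} → i ≢ j → a i + a j ≤ s
  a-pair≤s i≢j = subst (_ ≤_) sum-a (pair≤sum a i≢j)

  three-classes-bound : ∀ {p q l} → Unique (p ∷ q ∷ l ∷ []) → a p + a q ≡ s → k ≤ b l + b p →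
                        m + k ≤ t + 3
  three-classes-bound {p} {q} {l} unique cover k≤bl+bp =
    mass⇒bound {m} {s = s} {t} {k} {3} (mass-bound unique) (begin
    s + k                                     ≤⟨ +-mono-≤ (≤-reflexive (sym cover)) k≤bp+bl ⟩
    (a p + a q) + (b p + b l)                 ≤⟨ m≤m+n _ (a l + b q) ⟩
    (a p + a q) + (b p + b l) + (a l + b q)   ≡⟨ regroup (a p) (b p) (a q) (b q) (a l) (b l) ⟩
    h p + (h q + (h l + 0))                   ∎)
    where
    open ≤-Reasoning
    k≤bp+bl : k ≤ b p + b l
    k≤bp+bl = subst (k ≤_) (+-comm (b l) (b p)) k≤bl+bp
    regroup : ∀ ap bp aq bq al bl → (ap + aq) + (bp + bl) + (al + bq) ≡ (ap + bp) + ((aq + bq) + ((al + bl) + 0))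
    regroup = solve-∀

  -- Here a l = 0, so the partner p carries at least k vertices of X and must be i or j.
  partner-through-X : 1 ≤ k → k ≤ s → ∀ {i j l p} → i ≢ j → a i + a j ≡ s → l ∉ i ∷ j ∷ [] →
                      ¬ Dom p →
                      (a l + a p ≡ s ⊎ k ≤ b l + b p) → k ≤ a l + a p → k < s × m + k ≤ t + 3
  partner-through-X 1≤k k≤s {i} {j} {l} {p} i≢j cover l∉ij ¬Dp X-condition k≤al+ap = k<s , partner-bound
    where
    a≡0 : ∀ {x} → x ∉ i ∷ j ∷ [] → a x ≡ 0
    a≡0 = a≡0-off-pair i≢j cover
    k≤ap : k ≤ a p
    k≤ap = subst (λ n → k ≤ n + a p) (a≡0 l∉ij) k≤al+ap
    ap≢s : a p ≢ s
    ap≢s ap≡s = ¬Dp (inj₁ ap≡s , inj₂ (subst (k ≤_) (sym ap≡s) k≤s))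
    k<s : k < s
    k<s = ≤-<-trans k≤ap (≤∧≢⇒< (a≤s p) ap≢s)
    k≤bl+bp : k ≤ b l + b p
    k≤bl+bp = [ (λ al+ap≡s → contradiction (subst (λ n → n + a p ≡ s) (a≡0 l∉ij) al+ap≡s) ap≢s) , id ]′
                X-condition
    l≢i = l∉ij ∘ here
    l≢j = l∉ij ∘ there ∘ here
    partner-bound : m + k ≤ t + 3
    partner-bound with p ≟ i | p ≟ j
    ... | yes refl | _        =
      three-classes-bound ((i≢j ∷ (l≢i ∘ sym) ∷ []) ∷ ((l≢j ∘ sym) ∷ []) ∷ [] ∷ []) cover k≤bl+bp
    ... | no _     | yes refl =
      three-classes-bound (((i≢j ∘ sym) ∷ (l≢j ∘ sym) ∷ []) ∷ ((l≢i ∘ sym) ∷ []) ∷ [] ∷ [])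
                          (trans (+-comm (a j) (a i)) cover) k≤bl+bp
    ... | no p≢i   | no p≢j   =
      contradiction (subst (k ≤_) (a≡0 λ { (here e) → p≢i e ; (there (here e)) → p≢j e }) k≤ap) (<⇒≱ 1≤k)

  -- Every other class lies in Y; a third class either is dominating only by containing Y,
  -- or completes Y with its partner, or takes k vertices of X from its partner.
  X-cover-bound : 1 ≤ k → k ≤ s → ∀ {i j} → i ≢ j → a i + a j ≡ s → m ≤ 4 ⊎ (k < s × m + k ≤ t + 3)
  X-cover-bound 1≤k k≤s {i} {j} i≢j cover with m ≤? 2
  ... | yes m≤2 = inj₁ (≤-trans m≤2 (s≤s (s≤s z≤n)))
  ... | no m≰2 with fresh (i ∷ j ∷ []) (≰⇒> m≰2)
  ... | l , l∉ij with valid l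
  ...   | inj₁ ((_ , inj₁ bl≡t) , _) =
    inj₁ (≤-trans (covered⇒m≤ (i ∷ j ∷ l ∷ []) (λ x∉ → a≡0-off-pair i≢j cover (x∉ ∘ ∈-++⁺ˡ))
                                                (λ x∉ → b≡0-off-single bl≡t (x∉ ∘ ∈-++⁺ʳ (i ∷ j ∷ []))))
                  (n≤1+n 3))
  ...   | inj₁ ((_ , inj₂ k≤al) , _) =
    contradiction (subst (k ≤_) (a≡0-off-pair i≢j cover l∉ij) k≤al) (<⇒≱ 1≤k)
  ...   | inj₂ (p , p≢l , _ , _ , _ , inj₁ cover-Y) =
    inj₁ (covered⇒m≤ (i ∷ j ∷ l ∷ p ∷ []) (λ x∉ → a≡0-off-pair i≢j cover (x∉ ∘ ∈-++⁺ˡ))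
                                          (λ x∉ → b≡0-off-pair (p≢l ∘ sym) cover-Y
                                                                (x∉ ∘ ∈-++⁺ʳ (i ∷ j ∷ []))))
  ...   | inj₂ (p , _ , _ , ¬Dp , X-condition , inj₂ k≤al+ap) =
    inj₂ (partner-through-X 1≤k k≤s i≢j cover l∉ij ¬Dp X-condition k≤al+ap)

  X-single-cover⇒pair : 2 ≤ m → ∀ {i} → a i ≡ s → ∃ λ j → i ≢ j × a i + a j ≡ s
  X-single-cover⇒pair 2≤m {i} ai≡s with fresh (i ∷ []) 2≤m
  ... | j , j∉[i] =
    j , (j∉[i] ∘ here ∘ sym) , trans (cong (a i +_) (a≡0-off-single ai≡s j∉[i])) (trans (+-identityʳ (a i)) ai≡s)

  -- For s < k a dominating set contains Y, so the partner of a class outside Y contains Y too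
  -- and is not dominating only if t < k; then the pair contains X as well.
  s<k⇒class-outside-Y⇒m≤2 : s < k → 1 ≤ t → ∀ {l} → b l ≡ 0 → m ≤ 2
  s<k⇒class-outside-Y⇒m≤2 s<k 1≤t {l} bl≡0 with valid l
  ... | inj₁ (dom , _) = contradiction (trans (sym (dominating⇒whole-Y s<k (a≤s l) dom)) bl≡0) (≢-sym (<⇒≢ 1≤t))
  ... | inj₂ (p , p≢l , _ , ¬Dp , dom) =
    covered⇒m≤ (l ∷ p ∷ []) (a≡0-off-pair (p≢l ∘ sym) al+ap≡s) (b≡0-off-pair (p≢l ∘ sym) bl+bp≡t)
    where
    bl+bp≡t : b l + b p ≡ t
    bl+bp≡t = dominating⇒whole-Y s<k (a-pair≤s (p≢l ∘ sym)) dom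
    bp≡t : b p ≡ t
    bp≡t = subst (λ n → n + b p ≡ t) bl≡0 bl+bp≡t
    k≰t : ¬ k ≤ t
    k≰t k≤t = ¬Dp (inj₂ (subst (k ≤_) (sym bp≡t) k≤t) , inj₁ bp≡t)
    al+ap≡s : a l + a p ≡ s
    al+ap≡s = [ id , (λ k≤ → contradiction (subst (k ≤_) bl+bp≡t k≤) k≰t) ]′ (proj₁ dom)

  s<k⇒m≤2 : s < k → 1 ≤ t → m ≤ 2
  s<k⇒m≤2 s<k 1≤t with m ≤? 2
  ... | yes m≤2 = m≤2
  ... | no m≰2 with fresh [] (≤-trans (s≤s z≤n) (≰⇒> m≰2))
  ... | c , _ with valid c
  ...   | inj₁ (dom , _) with fresh (c ∷ []) (≤-trans (s≤s (s≤s z≤n)) (≰⇒> m≰2))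
  ...     | l , l∉[c] =
    s<k⇒class-outside-Y⇒m≤2 s<k 1≤t (b≡0-off-single (dominating⇒whole-Y s<k (a≤s c) dom) l∉[c])
  s<k⇒m≤2 s<k 1≤t | no m≰2 | c , _ | inj₂ (j , j≢c , _ , _ , dom) with fresh (c ∷ j ∷ []) (≰⇒> m≰2)
  ...     | l , l∉cj =
    s<k⇒class-outside-Y⇒m≤2 s<k 1≤t
      (b≡0-off-pair (j≢c ∘ sym) (dominating⇒whole-Y s<k (a-pair≤s (j≢c ∘ sym)) dom) l∉cj)

module ManyClasses {s t k m} (P : CoalitionProfile s t k m)
                   (1≤k : 1 ≤ k) (k≤s : k ≤ s) (s≤t : s ≤ t) (5≤m : 5 ≤ m)
                   (¬bound₁ : k < s → m + k ≤ t + 3 → ⊥)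
                   (¬bound₂ : k < s → m + 4 * k ≤ s + t + 4 → ⊥) where
  open CoalitionProfile P
  open Bounds P
  private
    module Swapped = Bounds (swap-parts P)

    2≤m : 2 ≤ m
    2≤m = ≤-trans (s≤s (s≤s z≤n)) 5≤m

    m≰4 : ¬ m ≤ 4
    m≰4 = <⇒≱ 5≤m

  X-pair-not-cover : ∀ {i j} → i ≢ j → a i + a j ≢ s
  X-pair-not-cover i≢j cover with X-cover-bound 1≤k k≤s i≢j cover
  ... | inj₁ m≤4           = m≰4 m≤4
  ... | inj₂ (k<s , bound) = ¬bound₁ k<s bound

  Y-pair-not-cover : ∀ {i j} → i ≢ j → b i + b j ≢ t
  Y-pair-not-cover i≢j cover with Swapped.X-cover-bound 1≤k (≤-trans k≤s s≤t) i≢j cover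
  ... | inj₁ m≤4         = m≰4 m≤4
  ... | inj₂ (_ , bound) with k <? s
  ...   | yes k<s = ¬bound₁ k<s (≤-trans bound (+-monoˡ-≤ 3 s≤t))
  ...   | no k≮s  = m≰4 (≤-trans (+-cancelʳ-≤ k m 3 (≤-trans bound (≤-reflexive s+3≡3+k))) (n≤1+n 3))
    where
    s+3≡3+k : s + 3 ≡ 3 + k
    s+3≡3+k = trans (+-comm s 3) (cong (3 +_) (≤-antisym (≮⇒≥ k≮s) k≤s))

  X-single-not-cover : ∀ {i} → a i ≢ s
  X-single-not-cover ai≡s = let _ , i≢j , cover = X-single-cover⇒pair 2≤m ai≡s in X-pair-not-cover i≢j cover

  Y-single-not-cover : ∀ {i} → b i ≢ t
  Y-single-not-cover bi≡t = let _ , i≢j , cover = Swapped.X-single-cover⇒pair 2≤m bi≡t in Y-pair-not-cover i≢j cover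

  class-not-dominating : ∀ x → ¬ Dom x
  class-not-dominating x dom with valid x | dominating-interior dom X-single-not-cover Y-single-not-cover
  ... | inj₂ (_ , _ , ¬dom , _) | _           = ¬dom dom
  ... | inj₁ (_ , size)         | k≤a , k≤b = <⇒≱ 1≤k (+-cancelˡ-≤ k k 0 (begin
    k + k      ≤⟨ +-mono-≤ k≤a k≤b ⟩
    a x + b x  ≡⟨ size ⟩
    k          ≡⟨ +-identityʳ k ⟨
    k + 0      ∎))
    where open ≤-Reasoning

  Heavy : Fin m → Fin m → Set
  Heavy i j = k ≤ a i + a j × k ≤ b i + b j

  Heavy-sym : ∀ {i j} → Heavy i j → Heavy j i
  Heavy-sym {i} {j} (k≤a , k≤b) = subst (k ≤_) (+-comm (a i) (a j)) k≤a , subst (k ≤_) (+-comm (b i) (b j)) k≤b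

  heavy-partner : ∀ x → ∃ λ p → p ≢ x × Heavy x p
  heavy-partner x with valid x
  ... | inj₁ (dom , _) = ⊥-elim (class-not-dominating x dom)
  ... | inj₂ (p , p≢x , _ , _ , dom) =
    p , p≢x , dominating-interior dom (X-pair-not-cover (p≢x ∘ sym)) (Y-pair-not-cover (p≢x ∘ sym))

  k<s : k < s
  k<s with fresh [] (≤-trans (s≤s z≤n) 5≤m)
  ... | c , _ with heavy-partner c
  ... | p , p≢c , k≤ac+ap , _ =
    ≤-<-trans k≤ac+ap (≤∧≢⇒< (a-pair≤s (p≢c ∘ sym)) (X-pair-not-cover (p≢c ∘ sym)))

  no-disjoint-heavy : ∀ {i j l o} → Unique (i ∷ j ∷ l ∷ o ∷ []) → Heavy i j → Heavy l o → ⊥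
  no-disjoint-heavy {i} {j} {l} {o} unique (k≤aij , k≤bij) (k≤alo , k≤blo) =
    ¬bound₂ k<s (≤-trans (+-monoʳ-≤ m 4k≤mass) (mass-bound unique))
    where
    open ≤-Reasoning
    four-times : ∀ k → 4 * k ≡ k + k + k + k
    four-times = solve-∀
    regroup : ∀ ai bi aj bj al bl ao bo →
              (ai + aj) + (bi + bj) + (al + ao) + (bl + bo) ≡ (ai + bi) + ((aj + bj) + ((al + bl) + ((ao + bo) + 0)))
    regroup = solve-∀
    4k≤mass : 4 * k ≤ h i + (h j + (h l + (h o + 0)))
    4k≤mass = begin
      4 * k
        ≡⟨ four-times k ⟩
      k + k + k + k
        ≤⟨ +-mono-≤ (+-mono-≤ (+-mono-≤ k≤aij k≤bij) k≤alo) k≤blo ⟩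
      (a i + a j) + (b i + b j) + (a l + a o) + (b l + b o)
        ≡⟨ regroup (a i) (b i) (a j) (b j) (a l) (b l) (a o) (b o) ⟩
      h i + (h j + (h l + (h o + 0)))
        ∎

  impossible : ⊥
  impossible with star-centre Heavy Heavy-sym heavy-partner no-disjoint-heavy (≤-trans (n≤1+n 4) 5≤m)
  ... | c , heavy-with-c with non-dominating⇒small (class-not-dominating c)
  ... | inj₁ ac<k = ¬bound₁ k<s (begin
    m + k      ≤⟨ star-sum-bound a c ac<k (λ x x≢c → proj₁ (heavy-with-c x x≢c)) 2≤m ⟩
    sum a + 2  ≡⟨ cong (_+ 2) sum-a ⟩
    s + 2      ≤⟨ +-mono-≤ s≤t (n≤1+n 2) ⟩
    t + 3      ∎)
    where open ≤-Reasoning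
  ... | inj₂ bc<k = ¬bound₁ k<s (begin
    m + k      ≤⟨ star-sum-bound b c bc<k (λ x x≢c → proj₂ (heavy-with-c x x≢c)) 2≤m ⟩
    sum b + 2  ≡⟨ cong (_+ 2) sum-b ⟩
    t + 2      ≤⟨ +-monoʳ-≤ t (n≤1+n 2) ⟩
    t + 3      ∎)
    where open ≤-Reasoning

upper-bound : ∀ {s t k m} → CoalitionProfile s t k m → 1 ≤ k → k ≤ s → s ≤ t →
              m ≤ 4 ⊎ (k < s × (m + k ≤ t + 3 ⊎ m + 4 * k ≤ s + t + 4))
upper-bound {s} {t} {k} {m} P 1≤k k≤s s≤t with m ≤? 4
... | yes m≤4 = inj₁ m≤4
... | no m≰4 with k <? s
...   | no k≮s =
  ⊥-elim (ManyClasses.impossible P 1≤k k≤s s≤t (≰⇒> m≰4) (λ k<s _ → k≮s k<s) (λ k<s _ → k≮s k<s))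
...   | yes k<s with m + k ≤? t + 3 | m + 4 * k ≤? s + t + 4
...     | yes bound₁ | _          = inj₂ (k<s , inj₁ bound₁)
...     | no _       | yes bound₂ = inj₂ (k<s , inj₂ bound₂)
...     | no ¬bound₁ | no ¬bound₂ =
  ⊥-elim (ManyClasses.impossible P 1≤k k≤s s≤t (≰⇒> m≰4) (λ _ → ¬bound₁) (λ _ → ¬bound₂))

-- Constructions

dominating-all : ∀ {s t k A B} → A ≡ s → B ≡ t → Dominating s t k A B
dominating-all A≡s B≡t = inj₁ A≡s , inj₁ B≡t

dominating-X : ∀ {s t k A B} → A ≡ s → k ≤ s → Dominating s t k A B
dominating-X refl k≤s = inj₁ refl , inj₂ k≤s

dominating-Y : ∀ {s t k A B} → B ≡ t → k ≤ t → Dominating s t k A B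
dominating-Y refl k≤t = inj₂ k≤t , inj₁ refl

dominating-k-k : ∀ {s t k A B} → k ≤ A → k ≤ B → Dominating s t k A B
dominating-k-k k≤A k≤B = inj₂ k≤B , inj₂ k≤A

not-dominating-X : ∀ {s t k A B} → A ≢ s → B < k → ¬ Dominating s t k A B
not-dominating-X A≢s B<k (X-condition , _) = [ A≢s , <⇒≱ B<k ]′ X-condition

not-dominating-Y : ∀ {s t k A B} → B ≢ t → A < k → ¬ Dominating s t k A B
not-dominating-Y B≢t A<k (_ , Y-condition) = [ B≢t , <⇒≱ A<k ]′ Y-condition

coalition-class : ∀ {s t k m} {a b : Fin m → ℕ} {i} j {A B} → a i ≡ A → b i ≡ B → j ≢ i →
                  ¬ Dominating s t k A B → ¬ Dominating s t k (a j) (b j) → Dominating s t k (A + a j) (B + b j) →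
                  IsValidClass s t k a b i
coalition-class j refl refl j≢i ¬dom ¬dom′ dom = inj₂ (j , j≢i , ¬dom , ¬dom′ , dom)

profile-s<k : ∀ {s t k} → 1 ≤ s → s ≤ t → 2 ≤ k → s < k → CoalitionProfile s t k 2
profile-s<k {t = zero} () z≤n _ _
profile-s<k {s} {suc t′} {k} 1≤s _ 2≤k s<k = record
  { a = λ { zero → s ; (suc zero) → 0 }
  ; b = λ { zero → t′ ; (suc zero) → 1 }
  ; sum-a = +-identityʳ s
  ; sum-b = +-comm t′ 1
  ; nonempty = λ { zero → ≤-trans 1≤s (m≤m+n s t′) ; (suc zero) → ≤-refl }
  ; valid = λ { zero       → inj₂ (suc zero , (λ ()) , ¬D₀ , ¬D₁ , dominating-all (+-identityʳ s) (+-comm t′ 1))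
              ; (suc zero) → inj₂ (zero , (λ ()) , ¬D₁ , ¬D₀ , dominating-all refl refl) }
  }
  where
  ¬D₀ : ¬ Dominating s (suc t′) k s t′
  ¬D₀ = not-dominating-Y (≢-sym 1+n≢n) s<k
  ¬D₁ : ¬ Dominating s (suc t′) k 0 1
  ¬D₁ = not-dominating-X (<⇒≢ 1≤s) 2≤k

profile-s≡k : ∀ {s t k} → s ≡ k → s ≤ t → 2 ≤ k → CoalitionProfile s t k 4
profile-s≡k {suc k′} {suc t′} refl (s≤s k′≤t′) (s≤s 1≤k′) = record
  { a = λ { zero → k′ ; (suc zero) → 0  ; (suc (suc zero)) → 1 ; (suc (suc (suc zero))) → 0 }
  ; b = λ { zero → 0  ; (suc zero) → t′ ; (suc (suc zero)) → 0 ; (suc (suc (suc zero))) → 1 }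
  ; sum-a = +-comm k′ 1
  ; sum-b = +-comm t′ 1
  ; nonempty = λ { zero → ≤-trans 1≤k′ (m≤m+n k′ 0) ; (suc zero) → ≤-trans 1≤k′ k′≤t′
                 ; (suc (suc zero)) → ≤-refl ; (suc (suc (suc zero))) → ≤-refl }
  ; valid = λ { zero → inj₂ (suc (suc zero) , (λ ()) , ¬D₀ , ¬Dˣ , dominating-X (+-comm k′ 1) ≤-refl)
              ; (suc zero) →
                  inj₂ (suc (suc (suc zero)) , (λ ()) , ¬D₁ , ¬Dʸ , dominating-Y (+-comm t′ 1) (s≤s k′≤t′))
              ; (suc (suc zero)) → inj₂ (zero , (λ ()) , ¬Dˣ , ¬D₀ , dominating-X refl ≤-refl)
              ; (suc (suc (suc zero))) → inj₂ (suc zero , (λ ()) , ¬Dʸ , ¬D₁ , dominating-Y refl (s≤s k′≤t′)) }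
  }
  where
  Dom : ℕ → ℕ → Set
  Dom = Dominating (suc k′) (suc t′) (suc k′)
  ¬D₀ : ¬ Dom k′ 0
  ¬D₀ = not-dominating-X (≢-sym 1+n≢n) (s≤s z≤n)
  ¬D₁ : ¬ Dom 0 t′
  ¬D₁ = not-dominating-Y (≢-sym 1+n≢n) (s≤s z≤n)
  ¬Dˣ : ¬ Dom 1 0
  ¬Dˣ = not-dominating-X (λ 1≡k → <⇒≢ 1≤k′ (suc-injective 1≡k)) (s≤s z≤n)
  ¬Dʸ : ¬ Dom 0 1
  ¬Dʸ = not-dominating-Y (λ 1≡t → <⇒≢ (≤-trans 1≤k′ k′≤t′) (suc-injective 1≡t)) (s≤s z≤n)

profile-middle : ∀ {k′ s′ w} → 1 ≤ k′ → 1 ≤ s′ →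
                 CoalitionProfile (suc k′ + s′) (k′ + w) (suc k′) (2 + w)
profile-middle {k′} {s′} {w} 1≤k′ 1≤s′ = record
  { a = λ { zero → suc k′ ; (suc zero) → s′ ; (suc (suc _)) → 0 }
  ; b = λ { zero → k′     ; (suc zero) → 0  ; (suc (suc _)) → 1 }
  ; sum-a = trans (cong (λ n → suc k′ + (s′ + n)) (trans (sum-const w 0) (*-zeroʳ w)))
                  (cong (suc k′ +_) (+-identityʳ s′))
  ; sum-b = cong (k′ +_) (trans (sum-const w 1) (*-identityʳ w))
  ; nonempty = λ { zero → s≤s z≤n ; (suc zero) → ≤-trans 1≤s′ (m≤m+n s′ 0) ; (suc (suc _)) → ≤-refl }
  ; valid = λ { zero → inj₂ (suc zero , (λ ()) , ¬D₀ , ¬D₁ , dominating-X refl (m≤m+n (suc k′) s′))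
              ; (suc zero) →
                  inj₂ (zero , (λ ()) , ¬D₁ , ¬D₀ , dominating-X (+-comm s′ (suc k′)) (m≤m+n (suc k′) s′))
              ; (suc (suc _)) → inj₂ (zero , (λ ()) , ¬Dʸ , ¬D₀ , dominating-k-k ≤-refl ≤-refl) }
  }
  where
  Dom : ℕ → ℕ → Set
  Dom = Dominating (suc k′ + s′) (k′ + w) (suc k′)
  ¬D₀ : ¬ Dom (suc k′) k′
  ¬D₀ = not-dominating-X (<⇒≢ (m<m+n (suc k′) 1≤s′)) (n<1+n k′)
  ¬D₁ : ¬ Dom s′ 0
  ¬D₁ = not-dominating-X (<⇒≢ (m<n+m s′ (s≤s z≤n))) (s≤s z≤n)
  ¬Dʸ : ¬ Dom 0 1
  ¬Dʸ = not-dominating-X (λ ()) (s≤s 1≤k′)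

-- The coalition (k − 1, k) + (k, k − 1), with u singletons of X joining the first class and
-- w singletons of Y joining the second.
profile-large : ∀ {k′ u w} → 1 ≤ k′ →
                CoalitionProfile (k′ + (suc k′ + u)) (suc k′ + (k′ + w)) (suc k′) (2 + (u + w))
profile-large {k′} {u} {w} 1≤k′ = record
  { a = a ; b = b
  ; sum-a = cong (λ n → k′ + (suc k′ + n)) (trans (sum-++ (replicate u 1) (replicate w 0))
      (trans (cong₂ _+_ (trans (sum-const u 1) (*-identityʳ u)) (trans (sum-const w 0) (*-zeroʳ w))) (+-identityʳ u)))
  ; sum-b = cong (λ n → suc k′ + (k′ + n)) (trans (sum-++ (replicate u 0) (replicate w 1))
      (cong₂ _+_ (trans (sum-const u 0) (*-zeroʳ u)) (trans (sum-const w 1) (*-identityʳ w))))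
  ; nonempty = nonempty
  ; valid = valid
  }
  where
  S = k′ + (suc k′ + u)
  T = suc k′ + (k′ + w)
  a b : Fin (2 + (u + w)) → ℕ
  a = λ { zero → k′     ; (suc zero) → suc k′ ; (suc (suc r)) → (replicate u 1 ++ replicate w 0) r }
  b = λ { zero → suc k′ ; (suc zero) → k′     ; (suc (suc r)) → (replicate u 0 ++ replicate w 1) r }
  a-X-singleton : ∀ x → a (suc (suc (x ↑ˡ w))) ≡ 1
  a-X-singleton = lookup-++ˡ (replicate u 1) (replicate w 0)
  b-X-singleton : ∀ x → b (suc (suc (x ↑ˡ w))) ≡ 0
  b-X-singleton = lookup-++ˡ (replicate u 0) (replicate w 1)
  a-Y-singleton : ∀ y → a (suc (suc (u ↑ʳ y))) ≡ 0
  a-Y-singleton = lookup-++ʳ (replicate u 1) (replicate w 0)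
  b-Y-singleton : ∀ y → b (suc (suc (u ↑ʳ y))) ≡ 1
  b-Y-singleton = lookup-++ʳ (replicate u 0) (replicate w 1)
  nonempty : ∀ i → 1 ≤ a i + b i
  nonempty zero          = ≤-trans (s≤s z≤n) (m≤n+m (suc k′) k′)
  nonempty (suc zero)    = s≤s z≤n
  nonempty (suc (suc r)) with side u w r
  ... | left x  = subst (1 ≤_) (sym (cong₂ _+_ (a-X-singleton x) (b-X-singleton x))) ≤-refl
  ... | right y = subst (1 ≤_) (sym (cong₂ _+_ (a-Y-singleton y) (b-Y-singleton y))) ≤-refl
  Dom : ℕ → ℕ → Set
  Dom = Dominating S T (suc k′)
  k<S : suc k′ < S
  k<S = ≤-trans (m<n+m (suc k′) 1≤k′) (+-monoʳ-≤ k′ (m≤m+n (suc k′) u))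
  ¬D₀ : ¬ Dom k′ (suc k′)
  ¬D₀ = not-dominating-Y (<⇒≢ (m<m+n (suc k′) (≤-trans 1≤k′ (m≤m+n k′ w)))) (n<1+n k′)
  ¬D₁ : ¬ Dom (suc k′) k′
  ¬D₁ = not-dominating-X (<⇒≢ k<S) (n<1+n k′)
  ¬Dˣ : ¬ Dom 1 0
  ¬Dˣ = not-dominating-X (<⇒≢ (≤-trans (s≤s (s≤s z≤n)) k<S)) (s≤s z≤n)
  ¬Dʸ : ¬ Dom 0 1
  ¬Dʸ = not-dominating-X (<⇒≢ (≤-trans (s≤s z≤n) k<S)) (s≤s 1≤k′)
  valid : ∀ i → IsValidClass S T (suc k′) a b i
  valid zero       = inj₂ (suc zero , (λ ()) , ¬D₀ , ¬D₁ , dominating-k-k (m≤n+m _ k′) (m≤m+n (suc k′) k′))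
  valid (suc zero) = inj₂ (zero , (λ ()) , ¬D₁ , ¬D₀ , dominating-k-k (m≤m+n (suc k′) k′) (m≤n+m _ k′))
  valid (suc (suc r)) with side u w r
  ... | left x  = coalition-class zero (a-X-singleton x) (b-X-singleton x) (λ ())
                    ¬Dˣ ¬D₀ (dominating-k-k ≤-refl ≤-refl)
  ... | right y = coalition-class (suc zero) (a-Y-singleton y) (b-Y-singleton y) (λ ())
                    ¬Dʸ ¬D₁ (dominating-k-k ≤-refl ≤-refl)

reindex : ∀ {s t k m s′ t′ m′} → s ≡ s′ → t ≡ t′ → m ≡ m′ →
          CoalitionProfile s t k m → CoalitionProfile s′ t′ k m′
reindex refl refl refl P = P

lower-middle : ∀ {s t k} → k + 1 ≤ s → s ≤ t → 2 ≤ k → CoalitionProfile s t k (t ∸ k + 3)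
lower-middle {s} {t} {suc k′} k+1≤s s≤t (s≤s 1≤k′)
  with m≤n⇒∃[o]m+o≡n k+1≤s | m≤n⇒∃[o]m+o≡n (≤-trans (m≤m+n (suc k′) 1) (≤-trans k+1≤s s≤t))
... | o , refl | w , refl =
  reindex (s-eq k′ o) (+-suc k′ w) w+3 (profile-middle {k′} {suc o} {suc w} 1≤k′ (s≤s z≤n))
  where
  s-eq : ∀ k′ o → suc k′ + suc o ≡ suc k′ + 1 + o
  s-eq = solve-∀
  w+3 : 2 + suc w ≡ suc k′ + w ∸ suc k′ + 3
  w+3 = trans (+-comm 3 w) (cong (_+ 3) (sym (m+n∸m≡n (suc k′) w)))

large-s-room : ∀ {s k′} → 1 ≤ k′ → 3 * suc k′ ≤ s + 1 → k′ + (suc k′ + 2) ≤ s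
large-s-room {s} {k′} 1≤k′ 3k≤s+1 = +-cancelʳ-≤ 1 _ s (begin
  k′ + (suc k′ + 2) + 1   ≡⟨ regroup₁ k′ ⟩
  k′ + k′ + 3 + 1         ≤⟨ +-monoʳ-≤ (k′ + k′ + 3) 1≤k′ ⟩
  k′ + k′ + 3 + k′        ≡⟨ regroup₂ k′ ⟩
  3 * suc k′              ≤⟨ 3k≤s+1 ⟩
  s + 1                   ∎)
  where
  open ≤-Reasoning
  regroup₁ : ∀ k′ → k′ + (suc k′ + 2) + 1 ≡ k′ + k′ + 3 + 1
  regroup₁ = solve-∀
  regroup₂ : ∀ k′ → k′ + k′ + 3 + k′ ≡ 3 * suc k′
  regroup₂ = solve-∀

lower-large : ∀ {s t k} → 3 * k ≤ s + 1 → s ≤ t → 2 ≤ k → CoalitionProfile s t k (s + t ∸ 4 * k + 4)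
lower-large {s} {t} {suc k′} 3k≤s+1 s≤t (s≤s 1≤k′)
  with m≤n⇒∃[o]m+o≡n (large-s-room 1≤k′ 3k≤s+1)
     | m≤n⇒∃[o]m+o≡n (≤-trans (≤-reflexive (+-comm (suc k′) k′))
                      (≤-trans (+-monoʳ-≤ k′ (m≤m+n (suc k′) 2)) (≤-trans (large-s-room 1≤k′ 3k≤s+1) s≤t)))
... | u , refl | w , refl =
  reindex (regroup-s k′ u) (sym (+-assoc (suc k′) k′ w)) (sym m-eq) (profile-large {k′} {suc (suc u)} {w} 1≤k′)
  where
  regroup-s : ∀ k′ u → k′ + (suc k′ + suc (suc u)) ≡ k′ + (suc k′ + 2) + u
  regroup-s = solve-∀
  regroup-st : ∀ k′ u w → k′ + (suc k′ + 2) + u + (suc k′ + k′ + w) ≡ 4 * suc k′ + (u + w)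
  regroup-st = solve-∀
  m-eq : k′ + (suc k′ + 2) + u + (suc k′ + k′ + w) ∸ 4 * suc k′ + 4 ≡ 4 + (u + w)
  m-eq = begin
    k′ + (suc k′ + 2) + u + (suc k′ + k′ + w) ∸ 4 * suc k′ + 4
      ≡⟨ cong (λ n → n ∸ 4 * suc k′ + 4) (regroup-st k′ u w) ⟩
    4 * suc k′ + (u + w) ∸ 4 * suc k′ + 4
      ≡⟨ cong (_+ 4) (m+n∸m≡n (4 * suc k′) (u + w)) ⟩
    u + w + 4
      ≡⟨ +-comm (u + w) 4 ⟩
    4 + (u + w)
      ∎
    where open ≡-Reasoning

shift-bound : ∀ {m n o p} → n ≤ o → m + n ≤ o + p → m ≤ o ∸ n + p
shift-bound {m} {p = p} n≤o m+n≤o+p = subst (m ≤_) (+-∸-comm p n≤o) (m+n≤o⇒m≤o∸n m m+n≤o+p)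

upper-middle : ∀ {s t k m} → k + 1 ≤ s → s + 2 ≤ 3 * k → s ≤ t →
               m ≤ 4 ⊎ (k < s × (m + k ≤ t + 3 ⊎ m + 4 * k ≤ s + t + 4)) → m ≤ t ∸ k + 3
upper-middle {s} {t} {k} {m} k+1≤s s+2≤3k s≤t = λ
  { (inj₁ m≤4)              → ≤-trans m≤4 (+-monoˡ-≤ 3 (m<n⇒0<n∸m k<t))
  ; (inj₂ (_ , inj₁ bound₁)) → shift-bound (<⇒≤ k<t) bound₁
  ; (inj₂ (_ , inj₂ bound₂)) →
      shift-bound (<⇒≤ k<t) (≤-trans (three-k-cancelled bound₂) (+-monoʳ-≤ t (n≤1+n 2)))
  }
  where
  k<t : k < t
  k<t = ≤-trans (≤-reflexive (+-comm 1 k)) (≤-trans k+1≤s s≤t)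
  three-k-cancelled : m + 4 * k ≤ s + t + 4 → m + k ≤ t + 2
  three-k-cancelled bound₂ = +-cancelˡ-≤ (3 * k) _ _ (begin
    3 * k + (m + k)   ≡⟨ regroup₁ k m ⟩
    m + 4 * k         ≤⟨ bound₂ ⟩
    s + t + 4         ≡⟨ regroup₂ s t ⟩
    s + 2 + (t + 2)   ≤⟨ +-monoˡ-≤ (t + 2) s+2≤3k ⟩
    3 * k + (t + 2)   ∎)
    where
    open ≤-Reasoning
    regroup₁ : ∀ k m → 3 * k + (m + k) ≡ m + 4 * k
    regroup₁ = solve-∀
    regroup₂ : ∀ s t → s + t + 4 ≡ s + 2 + (t + 2)
    regroup₂ = solve-∀

upper-large : ∀ {s t k m} → 3 * k ≤ s + 1 → s ≤ t → 2 ≤ k →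
              m ≤ 4 ⊎ (k < s × (m + k ≤ t + 3 ⊎ m + 4 * k ≤ s + t + 4)) → m ≤ s + t ∸ 4 * k + 4
upper-large {s} {t} {k} {m} 3k≤s+1 s≤t 2≤k = λ
  { (inj₁ m≤4)              → ≤-trans m≤4 (m≤n+m 4 _)
  ; (inj₂ (_ , inj₁ bound₁)) → shift-bound 4k≤s+t (begin
      m + 4 * k          ≡⟨ regroup₁ m k ⟩
      m + k + 3 * k      ≤⟨ +-mono-≤ bound₁ 3k≤s+1 ⟩
      t + 3 + (s + 1)    ≡⟨ regroup₂ s t ⟩
      s + t + 4          ∎)
  ; (inj₂ (_ , inj₂ bound₂)) → shift-bound 4k≤s+t bound₂
  }
  where
  open ≤-Reasoning
  regroup₁ : ∀ m k → m + 4 * k ≡ m + k + 3 * k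
  regroup₁ = solve-∀
  regroup₂ : ∀ s t → t + 3 + (s + 1) ≡ s + t + 4
  regroup₂ = solve-∀
  k+1≤t : k + 1 ≤ t
  k+1≤t = +-cancelʳ-≤ 1 _ t (begin
    k + 1 + 1       ≡⟨ +-assoc k 1 1 ⟩
    k + 2           ≤⟨ +-monoʳ-≤ k 2≤k ⟩
    k + k           ≤⟨ +-monoʳ-≤ k (m≤m+n k (k + 0)) ⟩
    3 * k           ≤⟨ 3k≤s+1 ⟩
    s + 1           ≤⟨ +-monoˡ-≤ 1 s≤t ⟩
    t + 1           ∎)
  4k≤s+t : 4 * k ≤ s + t
  4k≤s+t = begin
    4 * k           ≡⟨ regroup₃ k ⟩
    3 * k + k       ≤⟨ +-monoˡ-≤ k 3k≤s+1 ⟩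
    s + 1 + k       ≡⟨ regroup₄ s k ⟩
    s + (k + 1)     ≤⟨ +-monoʳ-≤ s k+1≤t ⟩
    s + t           ∎
    where
    regroup₃ : ∀ k → 4 * k ≡ 3 * k + k
    regroup₃ = solve-∀
    regroup₄ : ∀ s k → s + 1 + k ≡ s + (k + 1)
    regroup₄ = solve-∀

coalition-number : ∀ {s t k c} → CoalitionProfile s t k c → (∀ {m} → CoalitionProfile s t k m → m ≤ c) →
                   KCoalitionNumberIs k (K s t) c
coalition-number P bound = profile⇒partition P , λ _ f partition → bound (partition⇒profile f partition)

k-coalition-number-s<k : ∀ {s t k} → 1 ≤ s → s ≤ t → 2 ≤ k → s < k → KCoalitionNumberIs k (K s t) 2
k-coalition-number-s<k 1≤s s≤t 2≤k s<k =
  coalition-number (profile-s<k 1≤s s≤t 2≤k s<k) λ P → Bounds.s<k⇒m≤2 P s<k (≤-trans 1≤s s≤t)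

k-coalition-number-s≡k : ∀ {s t k} → s ≡ k → s ≤ t → 2 ≤ k → KCoalitionNumberIs k (K s t) 4
k-coalition-number-s≡k refl s≤t 2≤k = coalition-number (profile-s≡k refl s≤t 2≤k) λ P →
  [ id , (λ { (k<k , _) → contradiction k<k (<-irrefl refl) }) ]′
    (upper-bound P (<⇒≤ 2≤k) ≤-refl s≤t)

k-coalition-number-middle : ∀ {s t k} → s ≤ t → 2 ≤ k → k + 1 ≤ s → s + 2 ≤ 3 * k →
                            KCoalitionNumberIs k (K s t) (t ∸ k + 3)
k-coalition-number-middle {k = k} s≤t 2≤k k+1≤s s+2≤3k = coalition-number (lower-middle k+1≤s s≤t 2≤k) λ P →
  upper-middle k+1≤s s+2≤3k s≤t (upper-bound P (<⇒≤ 2≤k) (≤-trans (m≤m+n k 1) k+1≤s) s≤t)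

k-coalition-number-large : ∀ {s t k} → s ≤ t → 2 ≤ k → 3 * k ≤ s + 1 →
                           KCoalitionNumberIs k (K s t) (s + t ∸ 4 * k + 4)
k-coalition-number-large {s} {k = k} s≤t 2≤k 3k≤s+1 = coalition-number (lower-large 3k≤s+1 s≤t 2≤k) λ P →
  upper-large 3k≤s+1 s≤t 2≤k (upper-bound P (<⇒≤ 2≤k) k≤s s≤t)
  where
  k≤s : k ≤ s
  k≤s = +-cancelʳ-≤ 1 k s (≤-trans (+-monoʳ-≤ k (≤-trans (<⇒≤ 2≤k) (m≤m+n k (k + 0)))) 3k≤s+1)

theorem5p2 : (s t k : ℕ) → 1 ≤ s → s ≤ t → 2 ≤ k →
    (s < k → KCoalitionNumberIs k (K s t) 2)
    × (s ≡ k → KCoalitionNumberIs k (K s t) 4)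
    × (k + 1 ≤ s → s + 2 ≤ 3 * k → KCoalitionNumberIs k (K s t) ((t ∸ k) + 3))
    × (3 * k ≤ s + 1 → KCoalitionNumberIs k (K s t) ((s + t ∸ 4 * k) + 4))
theorem5p2 s t k 1≤s s≤t 2≤k =
    k-coalition-number-s<k 1≤s s≤t 2≤k
  , (λ s≡k → k-coalition-number-s≡k s≡k s≤t 2≤k)
  , k-coalition-number-middle s≤t 2≤k
  , k-coalition-number-large s≤t 2≤k
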